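{- Let $b\ge1$ and $n\ge1$. The map $\kappa$ defined in the context is a bijection from the set of heaps of type I for $(1,b)$-Dyck paths of size $n$ onto the set of heaps of type II for $(1,b)$-Dyck paths of size $n$.
   Context: Lattice paths use $U=(0,1)$ and $D=(1,0)$. A $(1,b)$-Dyck path of size $n$ is a path from $(0,0)$ to $(bn,n)$ whose $i$-th up step is preceded by at least $b(i-1)$ right steps. **Type I.** A peak is an occurrence $UD$, with coordinate $(i,j)$ the point between its $U$ and $D$. The heap of type I of such a path $\mu$ is encoded by its set of staircases: one segment $[l,r]$ for each peak $(i,j)$, with $l=bn-i$ and $r=b(n+1-j)+1$. Heaps of type I correspond bijectively to $(1,b)$-Dyck paths of size $n$. **Type II.** A heap of type II for $(1,b)$-Dyck paths of size $n$ is a heap in Viennot's sense with the following properties. It has $n+1$ pieces, each an integer segment $[c,c+b]$ with $c\ge1$, two pieces being concurrent iff they intersect. It has a unique maximal piece, and that piece has left abscissa $1$. A heap is a poset with labelling such that concurrent pieces are comparable and covering pieces are concurrent, taken up to isomorphism. **The map $\kappa$.** Let the staircases of the type I heap be $[l_1,r_1],\dots,[l_s,r_s]$ with $l_1<\dots<l_s$. Write $r_i=1+b\,p(i)$, and put $L_i=b\,p(i)-l_i$. Set $p(0)=0$, $L_0=0$ and $p(s+1)=n+1$. Define $c_0=1$ and $c_{p(i)}=L_i+1$ for $1\le i\le s$. For $0\le i\le s$ and $p(i)<q<p(i+1)$, define $c_q=L_i+b(q-p(i))+1$. Then $\kappa$ of the type I heap is the heap obtained by placing the piece $[c_q,c_q+b]$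 at height $n+1-q$ for $q=0,\dots,n$. Pieces are dropped in order of increasing height, i.e. $q=n,n-1,\dots,0$. -}

module Defs where

open import Data.Nat using (ℕ; zero; suc; _+_; _*_; _∸_; _≤_; _<_; _≤ᵇ_; NonZero)
open import Data.Nat.DivMod using (_/_)
open import Data.Bool using (if_then_else_)
open import Data.Fin using (Fin; toℕ)
open import Data.List using (List; []; _∷_; map; reverse; length; filter)
open import Data.Product using (Σ; Σ-syntax; ∃; ∃-syntax; _×_; _,_)
open import Data.Sum using (_⊎_)
open import Data.Unit using (⊤)
open import Relation.Nullary using (¬_)
open import Relation.Binary.PropositionalEquality using (_≡_; _≢_)
open import Relation.Binary.Construct.Closure.ReflexiveTransitive using (Star)
open import Function.Bundles using (_↔_; Inverse)

-- Lattice paths: U = (0,1) (up), D = (1,0) (right)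

data Step : Set where
  U D : Step

countU countD : List Step → ℕ
countU [] = 0
countU (U ∷ w) = suc (countU w)
countU (D ∷ w) = countU w
countD [] = 0
countD (U ∷ w) = countD w
countD (D ∷ w) = suc (countD w)

DyckPrefix : ℕ → ℕ → ℕ → List Step → Set
DyckPrefix b u d [] = ⊤
DyckPrefix b u d (U ∷ w) = (b * u ≤ d) × DyckPrefix b (suc u) d w
DyckPrefix b u d (D ∷ w) = DyckPrefix b u (suc d) w

IsDyck : ℕ → ℕ → List Step → Set
IsDyck b n w = DyckPrefix b 0 0 w × countU w ≡ n × countD w ≡ b * n

-- Peaks (occurrences of UD), with coordinate (i,j) of the point between U and D.
-- i = number of D steps so far, j = number of U steps so far (counter state).
mutual
  peaks : ℕ → ℕ → List Step → List (ℕ × ℕ)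
  peaks i j [] = []
  peaks i j (U ∷ w) = peaksAfterU i (suc j) w
  peaks i j (D ∷ w) = peaks (suc i) j w

  peaksAfterU : ℕ → ℕ → List Step → List (ℕ × ℕ)
  peaksAfterU i j [] = []
  peaksAfterU i j (U ∷ w) = peaksAfterU i (suc j) w
  peaksAfterU i j (D ∷ w) = (i , j) ∷ peaks (suc i) j w

staircase : ℕ → ℕ → ℕ × ℕ → ℕ × ℕ
staircase b n (i , j) = (b * n ∸ i , b * (suc n ∸ j) + 1)

-- The set of staircases of μ, listed by increasing left end l
-- (peaks are listed with strictly increasing i, hence reversed).
staircases : ℕ → ℕ → List Step → List (ℕ × ℕ)
staircases b n w = reverse (map (staircase b n) (peaks 0 0 w))

-- Heaps of type I for (1,b)-Dyck paths of size n: sets of staircases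
-- (as lists sorted by increasing l) of such paths.
TypeI : ℕ → ℕ → List (ℕ × ℕ) → Set
TypeI b n S = Σ[ w ∈ List Step ] (IsDyck b n w × staircases b n w ≡ S)

-- Heaps (Viennot): a poset with a labelling by pieces.
-- A piece is [c, c+b], recorded by its left abscissa c.

Concurrent : ℕ → ℕ → ℕ → Set
Concurrent b c c' = Σ[ x ∈ ℕ ] ((c ≤ x × x ≤ c + b) × (c' ≤ x × x ≤ c' + b))

record HeapData (m : ℕ) : Set₁ where
  field
    lab : Fin m → ℕ
    _≼_ : Fin m → Fin m → Set

module _ {m : ℕ} (H : HeapData m) where
  open HeapData H

  Covers : Fin m → Fin m → Set
  Covers x y = x ≼ y × x ≢ y × (∀ z → x ≼ z → z ≼ y → z ≡ x ⊎ z ≡ y)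

  IsMaximal : Fin m → Set
  IsMaximal x = ∀ z → x ≼ z → z ≡ x

  record IsHeap (b : ℕ) : Set where
    field
      refl′   : ∀ x → x ≼ x
      antisym : ∀ x y → x ≼ y → y ≼ x → x ≡ y
      trans′  : ∀ x y z → x ≼ y → y ≼ z → x ≼ z
      concurrent⇒comparable : ∀ x y → Concurrent b (lab x) (lab y) → x ≼ y ⊎ y ≼ x
      covering⇒concurrent : ∀ x y → Covers x y → Concurrent b (lab x) (lab y)

HeapIso : {m : ℕ} → HeapData m → HeapData m → Set
HeapIso {m} H H' =
  Σ[ σ ∈ (Fin m ↔ Fin m) ]
    ((∀ x → HeapData.lab H' (Inverse.to σ x) ≡ HeapData.lab H x) ×
     (∀ x y → (HeapData._≼_ H x y → HeapData._≼_ H' (Inverse.to σ x) (Inverse.to σ y)) ×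
              (HeapData._≼_ H' (Inverse.to σ x) (Inverse.to σ y) → HeapData._≼_ H x y)))

TypeII : (b n : ℕ) → HeapData (suc n) → Set
TypeII b n H =
  IsHeap H b ×
  (∀ x → 1 ≤ HeapData.lab H x) ×
  Σ[ x ∈ Fin (suc n) ] (IsMaximal H x × (∀ y → IsMaximal H y → y ≡ x) × HeapData.lab H x ≡ 1)

DropStep : (b : ℕ) {m : ℕ} → (Fin m → ℕ) → Fin m → Fin m → Set
DropStep b c x y = toℕ x < toℕ y × Concurrent b (c x) (c y)

drop : (b : ℕ) {m : ℕ} → (Fin m → ℕ) → HeapData m
drop b c = record { lab = c ; _≼_ = Star (DropStep b c) }

-- (p(i), L_i) for the staircases [l_i, r_i], r_i = 1 + b p(i), L_i = b p(i) - l_i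
pLs : (b : ℕ) .{{_ : NonZero b}} → List (ℕ × ℕ) → List (ℕ × ℕ)
pLs b S = map (λ { (l , r) → let p = (r ∸ 1) / b in (p , b * p ∸ l) }) S

-- (p(i), L_i) for the largest i ∈ {0,...,s} with p(i) ≤ q  (p(0) = 0, L_0 = 0)
lastBelow : ℕ → (ℕ × ℕ) → List (ℕ × ℕ) → ℕ × ℕ
lastBelow q cur [] = cur
lastBelow q cur ((p , L) ∷ rest) =
  lastBelow q (if p ≤ᵇ q then (p , L) else cur) rest

-- c_q = L_i + b (q - p(i)) + 1 where p(i) ≤ q < p(i+1)
-- (this gives c_0 = 1, c_{p(i)} = L_i + 1, and the stated formula otherwise)
cκ : (b : ℕ) .{{_ : NonZero b}} → List (ℕ × ℕ) → ℕ → ℕ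
cκ b S q with lastBelow q (0 , 0) (pLs b S)
... | (p , L) = L + b * (q ∸ p) + 1

-- κ: piece [c_q, c_q + b] at height n+1-q; dropped in order q = n, n-1, ..., 0,
-- i.e. the k-th dropped piece (k = 0..n) is the one with q = n - k.
κ : (b n : ℕ) .{{_ : NonZero b}} → List (ℕ × ℕ) → HeapData (suc n)
κ b n S = drop b (λ (k : Fin (suc n)) → cκ b S (n ∸ toℕ k))

-- A (1,b)-Dyck path of size n is determined by the abscissas A k of its up steps, which are
-- subject only to b k ≤ A k, monotonicity and A n = b n. The type II heap κ assigns to it is the
-- drop of the pieces with left ends g k = A k - b k + 1 (k = 0, …, n), and these g are exactly the
-- good sequences: g n = 1, g k ≥ 1 and g k ≤ g (k+1) + b.
-- Conversely, every heap is the drop of its pieces listed in its canonical linear extension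
-- (lower pieces first, incomparable ones from left to right). This is a total order because a
-- chain of concurrent pieces cannot pass from one side of a piece to the other without meeting a
-- piece concurrent with it. In a type II heap, consecutive pieces of this order form a good
-- sequence, which gives surjectivity; in the drop of a good sequence, the canonical order is the
-- drop order, so isomorphisms preserve it, which gives injectivity.

{-# OPTIONS --safe #-}
module Submission where

open import Defs
open import Data.Nat
  using (ℕ; zero; suc; _+_; _*_; _∸_; _≤_; _<_; _⊔_; _≤ᵇ_; NonZero; z≤n; s≤s; _≤?_; _<?_)
open import Data.Nat.Properties
open import Data.Nat.DivMod using (_/_; m*n/n≡m)
open import Data.Fin using (Fin; toℕ; fromℕ; fromℕ<; punchOut) renaming (zero to fzero; suc to fsuc)
import Data.Fin as Fin
open import Data.Fin.Properties
  using (toℕ-injective; toℕ<n; toℕ-fromℕ; toℕ-fromℕ<; fromℕ<-toℕ; any?; punchOut-injective; injective⇒≤)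
  renaming (_≟_ to _≟ᶠ_)
open import Data.Product using (Σ-syntax; ∃; _×_; _,_; proj₁; proj₂; uncurry)
open import Data.Sum using (_⊎_; inj₁; inj₂; [_,_]′)
import Data.Sum as Sum
open import Data.Empty using (⊥; ⊥-elim)
open import Data.Unit using (tt)
open import Data.List using (List; []; _∷_; _++_; replicate; map; reverse; find)
open import Data.List.Properties using (unfold-reverse; reverse-map; map-∘)
open import Data.Bool using (true; false)
open import Data.List.Relation.Unary.All using (All; []; _∷_)
import Data.List.Relation.Unary.All as All
open import Data.Maybe using (Maybe; just; nothing; maybe; fromMaybe)
import Data.Maybe as Maybe
open import Function using (id; _∘_)
open import Function.Definitions using (Injective)
open import Function.Bundles using (Inverse; mk↔ₛ′)
open import Function.Construct.Composition using (_↔-∘_)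
open import Function.Properties.Inverse using (↔-refl)
open import Relation.Nullary using (¬_; Dec; yes; no; contradiction)
open import Relation.Nullary.Decidable using (map′; _×-dec_; _⊎-dec_; ¬?; ¬¬-excluded-middle)
open import Relation.Binary.Core using (_Preserves_⟶_)
open import Relation.Binary.Definitions using (tri<; tri≈; tri>)
open import Relation.Binary.PropositionalEquality
  using (_≡_; _≢_; refl; sym; trans; cong; cong₂; subst; subst₂; module ≡-Reasoning)
open import Relation.Binary.Construct.Closure.ReflexiveTransitive using (ε; _◅_; _◅◅_)
import Relation.Binary.Construct.Closure.ReflexiveTransitive as Star

-- Concurrency of segments

module _ {b : ℕ} where

  concurrent⇒≤ : ∀ {c c′} → Concurrent b c c′ → c ≤ c′ + b × c′ ≤ c + b
  concurrent⇒≤ (_ , (c≤x , x≤c+b) , (c′≤x , x≤c′+b)) =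
    ≤-trans c≤x x≤c′+b , ≤-trans c′≤x x≤c+b

  ≤⇒concurrent : ∀ {c c′} → c ≤ c′ + b → c′ ≤ c + b → Concurrent b c c′
  ≤⇒concurrent {c} {c′} c≤ c′≤ =
    c ⊔ c′ , (m≤m⊔n c c′ , ⊔-lub (m≤m+n c b) c′≤) , (m≤n⊔m c c′ , ⊔-lub c≤ (m≤m+n c′ b))

  concurrent? : ∀ c c′ → Dec (Concurrent b c c′)
  concurrent? c c′ = map′ (uncurry ≤⇒concurrent) concurrent⇒≤ (c ≤? c′ + b ×-dec c′ ≤? c + b)

  concurrent-sym : ∀ {c c′} → Concurrent b c c′ → Concurrent b c′ c
  concurrent-sym (x , c∋x , c′∋x) = x , c′∋x , c∋x

  ≡⇒concurrent : ∀ {c c′} → c ≡ c′ → Concurrent b c c′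
  ≡⇒concurrent {c} refl = c , (≤-refl , m≤m+n c b) , (≤-refl , m≤m+n c b)

  ¬concurrent-<⇒apart : ∀ {c c′} → ¬ Concurrent b c c′ → c < c′ → c + b < c′
  ¬concurrent-<⇒apart {c} {c′} ¬k c<c′ with c′ ≤? c + b
  ... | yes c′≤ = contradiction (≤⇒concurrent (≤-trans (<⇒≤ c<c′) (m≤m+n c′ b)) c′≤) ¬k
  ... | no c′≰  = ≰⇒> c′≰

-- Finite searches and counting

toℕ-surjective : ∀ {m j} → j < m → ∃ λ (x : Fin m) → toℕ x ≡ j
toℕ-surjective j<m = fromℕ< j<m , toℕ-fromℕ< j<m

count : ∀ {m} {P : Fin m → Set} → (∀ x → Dec (P x)) → ℕ
count {zero}  P? = 0
count {suc m} P? with P? fzero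
... | yes _ = suc (count (P? ∘ fsuc))
... | no _  = count (P? ∘ fsuc)

count-mono : ∀ {m} {P Q : Fin m → Set} (P? : ∀ x → Dec (P x)) (Q? : ∀ x → Dec (Q x)) →
             (∀ x → P x → Q x) → count P? ≤ count Q?
count-mono {zero}  P? Q? P⇒Q = z≤n
count-mono {suc m} P? Q? P⇒Q with P? fzero | Q? fzero
... | yes _ | yes _ = s≤s (count-mono (P? ∘ fsuc) (Q? ∘ fsuc) (P⇒Q ∘ fsuc))
... | yes p | no ¬q = contradiction (P⇒Q fzero p) ¬q
... | no _  | yes _ = m≤n⇒m≤1+n (count-mono (P? ∘ fsuc) (Q? ∘ fsuc) (P⇒Q ∘ fsuc))
... | no _  | no _  = count-mono (P? ∘ fsuc) (Q? ∘ fsuc) (P⇒Q ∘ fsuc)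

count-strict : ∀ {m} {P Q : Fin m → Set} (P? : ∀ x → Dec (P x)) (Q? : ∀ x → Dec (Q x)) →
               (∀ x → P x → Q x) → ∀ w → Q w → ¬ P w → count P? < count Q?
count-strict {suc m} P? Q? P⇒Q fzero q ¬p with P? fzero | Q? fzero
... | yes p | _     = contradiction p ¬p
... | no _  | yes _ = s≤s (count-mono (P? ∘ fsuc) (Q? ∘ fsuc) (P⇒Q ∘ fsuc))
... | no _  | no ¬q = contradiction q ¬q
count-strict {suc m} P? Q? P⇒Q (fsuc w) q ¬p with P? fzero | Q? fzero
... | yes _ | yes _ = s≤s (count-strict (P? ∘ fsuc) (Q? ∘ fsuc) (P⇒Q ∘ fsuc) w q ¬p)
... | yes p | no ¬q = contradiction (P⇒Q fzero p) ¬q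
... | no _  | yes _ = m<n⇒m<1+n (count-strict (P? ∘ fsuc) (Q? ∘ fsuc) (P⇒Q ∘ fsuc) w q ¬p)
... | no _  | no _  = count-strict (P? ∘ fsuc) (Q? ∘ fsuc) (P⇒Q ∘ fsuc) w q ¬p

count≤ : ∀ {m} {P : Fin m → Set} (P? : ∀ x → Dec (P x)) → count P? ≤ m
count≤ {zero}  P? = z≤n
count≤ {suc m} P? with P? fzero
... | yes _ = s≤s (count≤ (P? ∘ fsuc))
... | no _  = m≤n⇒m≤1+n (count≤ (P? ∘ fsuc))

count< : ∀ {m} {P : Fin m → Set} (P? : ∀ x → Dec (P x)) → ∀ w → ¬ P w → count P? < m
count< {suc m} P? fzero ¬p with P? fzero
... | yes p = contradiction p ¬p
... | no _  = s≤s (count≤ (P? ∘ fsuc))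
count< {suc m} P? (fsuc w) ¬p with P? fzero
... | yes _ = s≤s (count< (P? ∘ fsuc) w ¬p)
... | no _  = m<n⇒m<1+n (count< (P? ∘ fsuc) w ¬p)

injective⇒surjective : ∀ {m} (f : Fin m → Fin m) → Injective _≡_ _≡_ f → ∀ y → ∃ λ x → f x ≡ y
injective⇒surjective {suc m} f f-inj y with any? (λ x → f x ≟ᶠ y)
... | yes found = found
... | no ¬found = contradiction (injective⇒≤ punched-injective) 1+n≰n
  where
  y≢f : ∀ x → y ≢ f x
  y≢f x y≡fx = ¬found (x , sym y≡fx)

  punched-injective : Injective _≡_ _≡_ (λ x → punchOut (y≢f x))
  punched-injective {x} {x′} = f-inj ∘ punchOut-injective (y≢f x) (y≢f x′)

¬¬-∀-Fin : ∀ {m} {P : Fin m → Set} → (∀ x → ¬ ¬ P x) → ¬ ¬ (∀ x → P x)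
¬¬-∀-Fin {zero}  ¬¬P ¬∀P = ¬∀P λ ()
¬¬-∀-Fin {suc m} ¬¬P ¬∀P =
  ¬¬P fzero λ P0 → ¬¬-∀-Fin (¬¬P ∘ fsuc) λ Psuc → ¬∀P λ { fzero → P0 ; (fsuc x) → Psuc x }

last-crossing : {P : ℕ → Set} → (∀ j → Dec (P j)) → ∀ {i k} → i < k → P i → ¬ P k →
                ∃ λ j → i ≤ j × j < k × P j × ¬ P (suc j)
last-crossing P? {i} {suc k} i<1+k Pi ¬P1+k with P? k
... | yes Pk = k , ≤-pred i<1+k , n<1+n k , Pk , ¬P1+k
... | no ¬Pk with m≤n⇒m<n∨m≡n (≤-pred i<1+k)
...   | inj₂ refl = contradiction Pi ¬Pk
...   | inj₁ i<k with last-crossing P? i<k Pi ¬Pk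
...     | j , i≤j , j<k , Pj , ¬P1+j = j , i≤j , m<n⇒m<1+n j<k , Pj , ¬P1+j

∸-telescope : ∀ {a b c} → a ≤ b → b ≤ c → (b ∸ a) + (c ∸ b) ≡ c ∸ a
∸-telescope {a} {b} {c} a≤b b≤c = begin
  (b ∸ a) + (c ∸ b) ≡⟨ +-comm (b ∸ a) (c ∸ b) ⟩
  (c ∸ b) + (b ∸ a) ≡⟨ +-∸-assoc (c ∸ b) a≤b ⟨
  (c ∸ b) + b ∸ a   ≡⟨ cong (_∸ a) (m∸n+n≡m b≤c) ⟩
  c ∸ a             ∎
  where open ≡-Reasoning

-- Heaps and their canonical linear extension

HeapIso-trans : ∀ {m} {H₁ H₂ H₃ : HeapData m} → HeapIso H₁ H₂ → HeapIso H₂ H₃ → HeapIso H₁ H₃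
HeapIso-trans (σ , σ-lab , σ-≼) (τ , τ-lab , τ-≼) =
  τ ↔-∘ σ ,
  (λ x → trans (τ-lab (Inverse.to σ x)) (σ-lab x)) ,
  (λ x y → proj₁ (τ-≼ _ _) ∘ proj₁ (σ-≼ x y) , proj₂ (σ-≼ x y) ∘ proj₂ (τ-≼ _ _))

drop-cong : ∀ {b m} {c c′ : Fin m → ℕ} → (∀ x → c x ≡ c′ x) → HeapIso (drop b c) (drop b c′)
drop-cong {b} {m} c≗c′ =
  ↔-refl , (λ x → sym (c≗c′ x)) , (λ x y → Star.map (relabel c≗c′) , Star.map (relabel (sym ∘ c≗c′)))
  where
  relabel : ∀ {d d′ : Fin m → ℕ} → (∀ x → d x ≡ d′ x) →
            ∀ {x y} → DropStep b d x y → DropStep b d′ x y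
  relabel d≗d′ {x} {y} (x<y , k) = x<y , subst₂ (Concurrent b) (d≗d′ x) (d≗d′ y) k

module Dropped (b : ℕ) {m : ℕ} (c : Fin m → ℕ) where
  open HeapData (drop b c) using (_≼_)

  ≼⇒≤ : ∀ {x y} → x ≼ y → toℕ x ≤ toℕ y
  ≼⇒≤ ε                = ≤-refl
  ≼⇒≤ ((x<z , _) ◅ z≼y) = ≤-trans (<⇒≤ x<z) (≼⇒≤ z≼y)

  drop-isHeap : IsHeap (drop b c) b
  drop-isHeap = record
    { refl′                 = λ _ → ε
    ; antisym               = λ _ _ x≼y y≼x → toℕ-injective (≤-antisym (≼⇒≤ x≼y) (≼⇒≤ y≼x))
    ; trans′                = λ _ _ _ → _◅◅_
    ; concurrent⇒comparable = comparable
    ; covering⇒concurrent   = covering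
    }
    where
    comparable : ∀ x y → Concurrent b (c x) (c y) → x ≼ y ⊎ y ≼ x
    comparable x y k with <-cmp (toℕ x) (toℕ y)
    ... | tri< x<y _ _ = inj₁ ((x<y , k) ◅ ε)
    ... | tri≈ _ x≡y _ = inj₁ (subst (x ≼_) (toℕ-injective x≡y) ε)
    ... | tri> _ _ y<x = inj₂ ((y<x , concurrent-sym k) ◅ ε)

    -- The first drop step out of x already reaches y.
    covering : ∀ x y → Covers (drop b c) x y → Concurrent b (c x) (c y)
    covering x y (ε , x≢x , _) = contradiction refl x≢x
    covering x y ((x<z , k) ◅ z≼y , _ , between) with between _ ((x<z , k) ◅ ε) z≼y
    ... | inj₁ refl = contradiction x<z (<-irrefl refl)
    ... | inj₂ refl = k

module Precedence {m : ℕ} (H : HeapData m) where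
  open HeapData H

  -- The canonical linear extension of a heap: incomparable pieces are taken from left to right.
  _◁_ : Fin m → Fin m → Set
  x ◁ y = ¬ y ≼ x × (x ≼ y ⊎ lab x < lab y)

  ◁-asym : ∀ {x y} → x ◁ y → ¬ y ◁ x
  ◁-asym (y⋠x , inj₁ x≼y) (x⋠y , _)       = x⋠y x≼y
  ◁-asym (y⋠x , inj₂ _)   (x⋠y , inj₁ y≼x) = y⋠x y≼x
  ◁-asym (_ , inj₂ x<y)   (_ , inj₂ y<x)   = <-asym x<y y<x

module _ {m : ℕ} {H H′ : HeapData m} where
  open Precedence H using (_◁_)
  open Precedence H′ using () renaming (_◁_ to _◁′_)

  HeapIso-◁ : (iso : HeapIso H H′) → ∀ {x y} →
              x ◁ y → Inverse.to (proj₁ iso) x ◁′ Inverse.to (proj₁ iso) y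
  HeapIso-◁ (σ , σ-lab , σ-≼) {x} {y} (y⋠x , x≼y∨x<y) =
    y⋠x ∘ proj₂ (σ-≼ y x) ,
    Sum.map (proj₁ (σ-≼ x y)) (subst₂ _<_ (sym (σ-lab x)) (sym (σ-lab y))) x≼y∨x<y

  HeapIso-◁⁻ : (iso : HeapIso H H′) → ∀ {x y} →
               x ◁′ y → Inverse.from (proj₁ iso) x ◁ Inverse.from (proj₁ iso) y
  HeapIso-◁⁻ (σ , σ-lab , σ-≼) {x} {y} x◁′y
    with subst₂ _◁′_ (sym (Inverse.strictlyInverseˡ σ x)) (sym (Inverse.strictlyInverseˡ σ y)) x◁′y
  ... | (y⋠x , x≼y∨x<y) =
    y⋠x ∘ proj₁ (σ-≼ (from y) (from x)) ,
    Sum.map (proj₂ (σ-≼ (from x) (from y))) (subst₂ _<_ (σ-lab (from x)) (σ-lab (from y))) x≼y∨x<y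
    where open Inverse σ using (from)

module HeapTheory {m : ℕ} (H : HeapData m) (b : ℕ) (isHeap : IsHeap H b) where
  open HeapData H
  open IsHeap isHeap
  open Precedence H public

  _⋖_ : Fin m → Fin m → Set
  x ⋖ y = Concurrent b (lab x) (lab y) × x ≼ y × x ≢ y

  _⋖?_ : ∀ x y → Dec (x ⋖ y)
  x ⋖? y with concurrent? (lab x) (lab y) | x ≟ᶠ y
  ... | no ¬k | _       = no (¬k ∘ proj₁)
  ... | yes _ | yes x≡y = no (λ (_ , _ , x≢y) → x≢y x≡y)
  ... | yes k | no x≢y  with concurrent⇒comparable x y k
  ...   | inj₁ x≼y = yes (k , x≼y , x≢y)
  ...   | inj₂ y≼x = no (λ (_ , x≼y , _) → x≢y (antisym x y x≼y y≼x))

  -- Chains of at most t steps; bounding the length makes them decidable.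
  data Chain : ℕ → Fin m → Fin m → Set where
    []  : ∀ {t x} → Chain t x x
    _∷_ : ∀ {t x y z} → x ⋖ y → Chain t y z → Chain (suc t) x z

  chain? : ∀ t x z → Dec (Chain t x z)
  chain? t x z with x ≟ᶠ z
  ... | yes refl = yes []
  chain? zero    x z | no x≢z = no λ { [] → x≢z refl }
  chain? (suc t) x z | no x≢z with any? (λ y → x ⋖? y ×-dec chain? t y z)
  ... | yes (_ , x⋖y , y→z) = yes (x⋖y ∷ y→z)
  ... | no ¬step            = no λ { [] → x≢z refl ; (x⋖y ∷ y→z) → ¬step (_ , x⋖y , y→z) }

  chain⇒≼ : ∀ {t x z} → Chain t x z → x ≼ z
  chain⇒≼ {x = x} []                      = refl′ x
  chain⇒≼ (_∷_ {x = x} {y} {z} (_ , x≼y , _) y→z) = trans′ x y z x≼y (chain⇒≼ y→z)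

  chain-weaken : ∀ {s t x z} → s ≤ t → Chain s x z → Chain t x z
  chain-weaken _         []          = []
  chain-weaken (s≤s s≤t) (x⋖y ∷ y→z) = x⋖y ∷ chain-weaken s≤t y→z

  chain-++ : ∀ {s t x y z} → Chain s x y → Chain t y z → Chain (s + t) x z
  chain-++ {s} {t} [] y→z = chain-weaken (m≤n+m t s) y→z
  chain-++ (x⋖w ∷ w→y) y→z = x⋖w ∷ chain-++ w→y y→z

  module ChainsOfDecidableOrder (_≼?_ : ∀ x y → Dec (x ≼ y)) where

    height : Fin m → ℕ
    height y = count (_≼? y)

    height-< : ∀ {x y} → x ≼ y → x ≢ y → height x < height y
    height-< {x} {y} x≼y x≢y =
      count-strict (_≼? x) (_≼? y) (λ z z≼x → trans′ z x y z≼x x≼y)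
                   y (refl′ y) (x≢y ∘ antisym x y x≼y)

    -- Split at any piece strictly between x and y; if there is none, y covers x.
    ≼⇒chain-height : ∀ fuel x y → height y ∸ height x < fuel → x ≼ y → Chain (height y ∸ height x) x y
    ≼⇒chain-height (suc fuel) x y bound x≼y with x ≟ᶠ y
    ... | yes refl = []
    ... | no x≢y with any? (λ z → x ≼? z ×-dec z ≼? y ×-dec ¬? (x ≟ᶠ z) ×-dec ¬? (z ≟ᶠ y))
    ...   | yes (z , x≼z , z≼y , x≢z , z≢y) =
      subst (λ t → Chain t x y) (∸-telescope (<⇒≤ hx<hz) (<⇒≤ hz<hy))
        (chain-++ (≼⇒chain-height fuel x z (<-≤-trans (∸-monoˡ-< hz<hy (<⇒≤ hx<hz)) (≤-pred bound)) x≼z)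
                  (≼⇒chain-height fuel z y (<-≤-trans (∸-monoʳ-< hx<hz (<⇒≤ hz<hy)) (≤-pred bound)) z≼y))
      where
      hx<hz = height-< x≼z x≢z
      hz<hy = height-< z≼y z≢y
    ...   | no ¬between = subst (λ t → Chain t x y) (sym (+-∸-assoc 1 (height-< x≼y x≢y)))
                            ((covering⇒concurrent x y covers , x≼y , x≢y) ∷ [])
      where
      covers : Covers H x y
      covers = x≼y , x≢y , λ z x≼z z≼y → case-between z x≼z z≼y
        where
        case-between : ∀ z → x ≼ z → z ≼ y → z ≡ x ⊎ z ≡ y
        case-between z x≼z z≼y with x ≟ᶠ z | z ≟ᶠ y
        ... | yes x≡z | _       = inj₁ (sym x≡z)
        ... | no _    | yes z≡y = inj₂ z≡y
        ... | no x≢z  | no z≢y  = contradiction (z , x≼z , z≼y , x≢z , z≢y) ¬between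

    ≼⇒chain : ∀ {x y} → x ≼ y → Chain m x y
    ≼⇒chain {x} {y} x≼y =
      chain-weaken (≤-trans (m∸n≤m (height y) (height x)) (count≤ (_≼? y)))
                   (≼⇒chain-height (suc (height y ∸ height x)) x y ≤-refl x≼y)

  -- ≼ need not be decidable, but Chain is; so ≼⇒chain may assume a decision procedure for ≼,
  -- which exists up to double negation because the carrier is finite.
  ≼⇒chain : ∀ {x y} → x ≼ y → Chain m x y
  ≼⇒chain {x} {y} x≼y with chain? m x y
  ... | yes x→y = x→y
  ... | no ¬x→y = ⊥-elim (¬¬-decidable λ _≼?_ → ¬x→y (ChainsOfDecidableOrder.≼⇒chain _≼?_ x≼y))
    where
    ¬¬-decidable : ¬ ¬ (∀ x y → Dec (x ≼ y))
    ¬¬-decidable = ¬¬-∀-Fin λ x → ¬¬-∀-Fin λ y → ¬¬-excluded-middle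

  _≼?_ : ∀ x y → Dec (x ≼ y)
  x ≼? y = map′ chain⇒≼ ≼⇒chain (chain? m x y)

  ≼∧≢⇒◁ : ∀ {x y} → x ≼ y → x ≢ y → x ◁ y
  ≼∧≢⇒◁ {x} {y} x≼y x≢y = x≢y ∘ antisym x y x≼y , inj₁ x≼y

  ◁-irrefl : ∀ {x} → ¬ x ◁ x
  ◁-irrefl {x} (x⋠x , _) = x⋠x (refl′ x)

  -- A chain running from the right of z to the left of z passes through a piece concurrent with z.
  ≼-crosses : ∀ {u v} z → u ≼ v → lab v < lab z → lab z < lab u → u ≼ z ⊎ z ≼ v
  ≼-crosses z u≼v = crosses (≼⇒chain u≼v)
    where
    crosses : ∀ {t u v} → Chain t u v → lab v < lab z → lab z < lab u → u ≼ z ⊎ z ≼ v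
    crosses [] v<z z<v = contradiction v<z (<-asym z<v)
    crosses {u = u} {v} (_∷_ {y = u′} (k , u≼u′ , _) u′→v) v<z z<u with concurrent? (lab u) (lab z)
    ... | yes k′ = Sum.map₂ (λ z≼u → trans′ z u v z≼u (trans′ u u′ v u≼u′ (chain⇒≼ u′→v)))
                            (concurrent⇒comparable u z k′)
    ... | no ¬k′ with lab z <? lab u′
    ...   | yes z<u′ = Sum.map₁ (trans′ u u′ z u≼u′) (crosses u′→v v<z z<u′)
    ...   | no z≮u′  = contradiction (proj₁ (concurrent⇒≤ k))
                         (<⇒≱ (≤-<-trans (+-monoˡ-≤ b (≮⇒≥ z≮u′))
                                          (¬concurrent-<⇒apart (¬k′ ∘ concurrent-sym) z<u)))

  ◁-trans-⋠ : ∀ {x y z} → x ◁ y → y ◁ z → ¬ z ≼ x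
  ◁-trans-⋠ {x} {y} {z} (_ , inj₁ x≼y) (z⋠y , _) z≼x = z⋠y (trans′ z x y z≼x x≼y)
  ◁-trans-⋠ {x} {y} {z} (y⋠x , inj₂ _) (_ , inj₁ y≼z) z≼x = y⋠x (trans′ y z x y≼z z≼x)
  ◁-trans-⋠ {x} {y} {z} (y⋠x , inj₂ x<y) (z⋠y , inj₂ y<z) z≼x =
    [ z⋠y , y⋠x ]′ (≼-crosses y z≼x x<y y<z)

  ◁-trans-≼∨< : ∀ {x y z} → x ◁ y → y ◁ z → ¬ z ≼ x → x ≼ z ⊎ lab x < lab z
  ◁-trans-≼∨< {x} {y} {z} (y⋠x , x≼y∨x<y) (z⋠y , y≼z∨y<z) z⋠x with lab x <? lab z
  ... | yes x<z = inj₂ x<z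
  ... | no x≮z with m≤n⇒m<n∨m≡n (≮⇒≥ x≮z) | x≼y∨x<y | y≼z∨y<z
  ...   | inj₂ z≡x | _        | _        =
    inj₁ ([ id , (λ z≼x → contradiction z≼x z⋠x) ]′
            (concurrent⇒comparable x z (≡⇒concurrent (sym z≡x))))
  ...   | inj₁ _   | inj₁ x≼y | inj₁ y≼z = inj₁ (trans′ x y z x≼y y≼z)
  ...   | inj₁ _   | inj₂ x<y | inj₂ y<z = contradiction (<-trans x<y y<z) x≮z
  ...   | inj₁ z<x | inj₁ x≼y | inj₂ y<z =
    inj₁ ([ id , (λ z≼y → contradiction z≼y z⋠y) ]′ (≼-crosses z x≼y y<z z<x))
  ...   | inj₁ z<x | inj₂ x<y | inj₁ y≼z =
    inj₁ ([ (λ y≼x → contradiction y≼x y⋠x) , id ]′ (≼-crosses x y≼z z<x x<y))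

  ◁-trans : ∀ {x y z} → x ◁ y → y ◁ z → x ◁ z
  ◁-trans x◁y y◁z = ◁-trans-⋠ x◁y y◁z , ◁-trans-≼∨< x◁y y◁z (◁-trans-⋠ x◁y y◁z)

  ◁-total : ∀ {x y} → x ≢ y → x ◁ y ⊎ y ◁ x
  ◁-total {x} {y} x≢y with x ≼? y | y ≼? x
  ... | yes x≼y | yes y≼x = contradiction (antisym x y x≼y y≼x) x≢y
  ... | yes x≼y | no y⋠x  = inj₁ (y⋠x , inj₁ x≼y)
  ... | no x⋠y  | yes y≼x = inj₂ (x⋠y , inj₁ y≼x)
  ... | no x⋠y  | no y⋠x with <-cmp (lab x) (lab y)
  ...   | tri< x<y _ _ = inj₁ (y⋠x , inj₂ x<y)
  ...   | tri> _ _ y<x = inj₂ (x⋠y , inj₂ y<x)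
  ...   | tri≈ _ x≡y _ = contradiction (concurrent⇒comparable x y (≡⇒concurrent x≡y)) [ x⋠y , y⋠x ]′

  _◁?_ : ∀ x y → Dec (x ◁ y)
  x ◁? y = ¬? (y ≼? x) ×-dec (x ≼? y ⊎-dec lab x <? lab y)

  rank : Fin m → ℕ
  rank x = count (_◁? x)

  rank-< : ∀ {x y} → x ◁ y → rank x < rank y
  rank-< {x} {y} x◁y = count-strict (_◁? x) (_◁? y) (λ z z◁x → ◁-trans z◁x x◁y) x x◁y ◁-irrefl

  rank<m : ∀ x → rank x < m
  rank<m x = count< (_◁? x) x ◁-irrefl

  rank-<⇒◁ : ∀ {x y} → rank x < rank y → x ◁ y
  rank-<⇒◁ {x} {y} rx<ry with x ≟ᶠ y
  ... | yes refl = contradiction rx<ry (<-irrefl refl)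
  ... | no x≢y   = [ id , (λ y◁x → contradiction (rank-< y◁x) (<-asym rx<ry)) ]′ (◁-total x≢y)

  rank-injective : ∀ {x y} → rank x ≡ rank y → x ≡ y
  rank-injective {x} {y} rx≡ry with x ≟ᶠ y
  ... | yes x≡y = x≡y
  ... | no x≢y with ◁-total x≢y
  ...   | inj₁ x◁y = contradiction rx≡ry (<⇒≢ (rank-< x◁y))
  ...   | inj₂ y◁x = contradiction (sym rx≡ry) (<⇒≢ (rank-< y◁x))

  rankᶠ : Fin m → Fin m
  rankᶠ x = fromℕ< (rank<m x)

  toℕ-rankᶠ : ∀ x → toℕ (rankᶠ x) ≡ rank x
  toℕ-rankᶠ x = toℕ-fromℕ< (rank<m x)

  rankᶠ-injective : Injective _≡_ _≡_ rankᶠ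
  rankᶠ-injective {x} {y} eq = rank-injective (begin
    rank x          ≡⟨ toℕ-rankᶠ x ⟨
    toℕ (rankᶠ x)   ≡⟨ cong toℕ eq ⟩
    toℕ (rankᶠ y)   ≡⟨ toℕ-rankᶠ y ⟩
    rank y          ∎)
    where open ≡-Reasoning

  opaque
    unrank : Fin m → Fin m
    unrank k = proj₁ (injective⇒surjective rankᶠ rankᶠ-injective k)

    rankᶠ-unrank : ∀ k → rankᶠ (unrank k) ≡ k
    rankᶠ-unrank k = proj₂ (injective⇒surjective rankᶠ rankᶠ-injective k)

  unrank-rankᶠ : ∀ x → unrank (rankᶠ x) ≡ x
  unrank-rankᶠ x = rankᶠ-injective (rankᶠ-unrank (rankᶠ x))

  rank-unrank : ∀ k → rank (unrank k) ≡ toℕ k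
  rank-unrank k = trans (sym (toℕ-rankᶠ (unrank k))) (cong toℕ (rankᶠ-unrank k))

  chain-head : ∀ {t x y} → Chain t x y → x ≢ y → ∃ λ w → x ⋖ w × w ≼ y
  chain-head []            x≢x = contradiction refl x≢x
  chain-head (x⋖w ∷ w→y) _   = _ , x⋖w , chain⇒≼ w→y

  concurrent-◁⇒≼ : ∀ {x y} → Concurrent b (lab x) (lab y) → x ◁ y → x ≼ y
  concurrent-◁⇒≼ {x} {y} k (y⋠x , _) = [ id , (λ y≼x → contradiction y≼x y⋠x) ]′
                                          (concurrent⇒comparable x y k)

  rank-max⇒maximal : ∀ {x} → suc (rank x) ≡ m → IsMaximal H x
  rank-max⇒maximal {x} 1+rx≡m z x≼z with z ≟ᶠ x
  ... | yes z≡x = z≡x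
  ... | no z≢x  =
    contradiction (subst (_≤ rank z) 1+rx≡m (rank-< (≼∧≢⇒◁ x≼z (z≢x ∘ sym)))) (<⇒≱ (rank<m z))

  -- If v lay more than b to the left of u, then u ≼ v, and the first step of a chain from u to v
  -- would come strictly between u and v in the canonical order.
  rank-suc⇒≤ : ∀ {u v} → rank v ≡ suc (rank u) → lab u ≤ lab v + b
  rank-suc⇒≤ {u} {v} rv≡1+ru with lab u ≤? lab v + b
  ... | yes u≤v+b = u≤v+b
  ... | no u≰v+b  = ⊥-elim (u⋪v (rank-<⇒◁ (subst (rank u <_) (sym rv≡1+ru) ≤-refl)))
    where
    nothing-between : ∀ {w} → u ◁ w → w ◁ v → ⊥
    nothing-between {w} u◁w w◁v = <⇒≱ (rank-< u◁w) (≤-pred (subst (rank w <_) rv≡1+ru (rank-< w◁v)))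

    u⋪v : ¬ u ◁ v
    u⋪v (_ , inj₂ u<v)    = <-asym u<v (≤-<-trans (m≤m+n (lab v) b) (≰⇒> u≰v+b))
    u⋪v (v⋠u , inj₁ u≼v) with chain-head (≼⇒chain u≼v) (λ u≡v → v⋠u (subst (_≼ u) u≡v (refl′ u)))
    ... | w , (k , u≼w , u≢w) , w≼v with w ≟ᶠ v
    ...   | yes refl = u≰v+b (proj₁ (concurrent⇒≤ k))
    ...   | no w≢v   = nothing-between (≼∧≢⇒◁ u≼w u≢w) (≼∧≢⇒◁ w≼v w≢v)

  drop-canonical≅ : HeapIso (drop b (lab ∘ unrank)) H
  drop-canonical≅ =
    mk↔ₛ′ unrank rankᶠ unrank-rankᶠ rankᶠ-unrank , (λ _ → refl) , λ k k′ → from-drop , to-drop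
    where
    open HeapData (drop b (lab ∘ unrank)) using () renaming (_≼_ to _≼ᵈ_)

    from-drop : ∀ {k k′} → k ≼ᵈ k′ → unrank k ≼ unrank k′
    from-drop ε = refl′ _
    from-drop {k} (_◅_ {j = k″} (k<k″ , k∥k″) k″≼k′) =
      trans′ _ _ _ (concurrent-◁⇒≼ k∥k″ (rank-<⇒◁ rk<rk″)) (from-drop k″≼k′)
      where rk<rk″ = subst₂ _<_ (sym (rank-unrank k)) (sym (rank-unrank k″)) k<k″

    chain⇒drop : ∀ {t x y} → Chain t x y → rankᶠ x ≼ᵈ rankᶠ y
    chain⇒drop [] = ε
    chain⇒drop (_∷_ {x = x} {y = w} (k , x≼w , x≢w) w→y) =
      (subst₂ _<_ (sym (toℕ-rankᶠ x)) (sym (toℕ-rankᶠ w)) (rank-< (≼∧≢⇒◁ x≼w x≢w)) ,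
       subst₂ (Concurrent b) (cong lab (sym (unrank-rankᶠ x))) (cong lab (sym (unrank-rankᶠ w))) k)
      ◅ chain⇒drop w→y

    to-drop : ∀ {k k′} → unrank k ≼ unrank k′ → k ≼ᵈ k′
    to-drop {k} {k′} u≼u′ =
      subst₂ _≼ᵈ_ (rankᶠ-unrank k) (rankᶠ-unrank k′) (chain⇒drop (≼⇒chain u≼u′))

-- Good sequences

record Good (b n : ℕ) (g : ℕ → ℕ) : Set where
  field
    last≡1   : g n ≡ 1
    positive : ∀ j → j ≤ n → 1 ≤ g j
    step     : ∀ j → j < n → g j ≤ g (suc j) + b

Good-cong : ∀ {b n g g′} → (∀ j → j ≤ n → g j ≡ g′ j) → Good b n g → Good b n g′
Good-cong {b} {n} g≗g′ good = record
  { last≡1   = trans (sym (g≗g′ n ≤-refl)) last≡1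
  ; positive = λ j j≤n → subst (1 ≤_) (g≗g′ j j≤n) (positive j j≤n)
  ; step     = λ j j<n → subst₂ (λ u v → u ≤ v + b) (g≗g′ j (<⇒≤ j<n)) (g≗g′ (suc j) j<n) (step j j<n)
  }
  where open Good good

heapOf : (b n : ℕ) → (ℕ → ℕ) → HeapData (suc n)
heapOf b n g = drop b (λ (k : Fin (suc n)) → g (toℕ k))

module GoodHeap {b n : ℕ} {g : ℕ → ℕ} (good : Good b n g) where
  open Good good
  open Dropped b (λ (k : Fin (suc n)) → g (toℕ k))
  open HeapData (heapOf b n g) using (_≼_)
  open Precedence (heapOf b n g)

  -- Take the last j < k whose segment still reaches g i. The sequence drops by at most b per step,
  -- so g j < g i: then j ≠ i, and the segments of i and j meet.
  bridge : ∀ {i k} → i < k → k ≤ n → g k + b < g i →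
           ∃ λ j → i < j × j < k × Concurrent b (g i) (g j) × g k < g j
  bridge {i} {k} i<k k≤n gk+b<gi
    with last-crossing (λ j → g i ≤? g j + b) i<k (m≤m+n (g i) b) (<⇒≱ gk+b<gi)
  ... | j , i≤j , j<k , gi≤gj+b , gi≰gj′+b =
    j , i<j , j<k , ≤⇒concurrent gi≤gj+b (≤-trans (<⇒≤ gj<gi) (m≤m+n (g i) b)) ,
    +-cancelʳ-< b (g k) (g j) (<-≤-trans gk+b<gi gi≤gj+b)
    where
    gj<gi : g j < g i
    gj<gi = ≤-<-trans (step j (<-≤-trans j<k k≤n)) (≰⇒> gi≰gj′+b)
    i<j : i < j
    i<j = ≤∧≢⇒< i≤j (λ { refl → <-irrefl refl gj<gi })

  ≤+b⇒≼ : ∀ fuel {x y} → toℕ y ≤ fuel + toℕ x →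
          toℕ x < toℕ y → g (toℕ y) ≤ g (toℕ x) + b → x ≼ y
  ≤+b⇒≼ fuel {x} {y} _ x<y y≤x+b with g (toℕ x) ≤? g (toℕ y) + b
  ... | yes x≤y+b = (x<y , ≤⇒concurrent x≤y+b y≤x+b) ◅ ε
  ≤+b⇒≼ zero y≤x x<y _ | no _ = contradiction y≤x (<⇒≱ x<y)
  ≤+b⇒≼ (suc fuel) {x} {y} y≤1+fuel+x x<y _ | no x≰y+b
    with bridge x<y (≤-pred (toℕ<n y)) (≰⇒> x≰y+b)
  ... | j , x<j , j<y , k , gy<gj with toℕ-surjective (<-trans j<y (toℕ<n y))
  ...   | z , refl = (x<j , k) ◅ ≤+b⇒≼ fuel y≤fuel+z j<y (≤-trans (<⇒≤ gy<gj) (m≤m+n _ b))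
    where
    y≤fuel+z : toℕ y ≤ fuel + toℕ z
    y≤fuel+z = ≤-trans y≤1+fuel+x (≤-trans (≤-reflexive (sym (+-suc fuel (toℕ x)))) (+-monoʳ-≤ fuel x<j))

  dichotomy : ∀ {x y} → toℕ x < toℕ y → x ≼ y ⊎ g (toℕ x) + b < g (toℕ y)
  dichotomy {x} {y} x<y with g (toℕ y) ≤? g (toℕ x) + b
  ... | yes y≤x+b = inj₁ (≤+b⇒≼ (toℕ y) (m≤m+n (toℕ y) (toℕ x)) x<y y≤x+b)
  ... | no y≰x+b  = inj₂ (≰⇒> y≰x+b)

  <⇒◁ : ∀ {x y} → toℕ x < toℕ y → x ◁ y
  <⇒◁ x<y = <⇒≱ x<y ∘ ≼⇒≤ , Sum.map₂ (≤-<-trans (m≤m+n _ b)) (dichotomy x<y)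

  ◁⇒< : ∀ {x y} → x ◁ y → toℕ x < toℕ y
  ◁⇒< {x} {y} x◁y with <-cmp (toℕ x) (toℕ y)
  ... | tri< x<y _ _ = x<y
  ... | tri≈ _ x≡y _ = contradiction (subst (_≼ x) (toℕ-injective x≡y) ε) (proj₁ x◁y)
  ... | tri> _ _ y<x = contradiction (<⇒◁ y<x) (◁-asym x◁y)

  ≼last : ∀ x → x ≼ fromℕ n
  ≼last x with m≤n⇒m<n∨m≡n (≤-pred (toℕ<n x))
  ... | inj₂ x≡n = subst (x ≼_) (toℕ-injective (trans x≡n (sym (toℕ-fromℕ n)))) ε
  ... | inj₁ x<n with dichotomy {x} {fromℕ n} (subst (toℕ x <_) (sym (toℕ-fromℕ n)) x<n)
  ...   | inj₁ x≼last   = x≼last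
  ...   | inj₂ x+b<last =
    contradiction (subst (g (toℕ x) + b <_) (trans (cong g (toℕ-fromℕ n)) last≡1) x+b<last)
                  (≤⇒≯ (≤-trans (positive (toℕ x) (<⇒≤ x<n)) (m≤m+n _ b)))

  heapOf-typeII : TypeII b n (heapOf b n g)
  heapOf-typeII =
    drop-isHeap ,
    (λ x → positive (toℕ x) (≤-pred (toℕ<n x))) ,
    fromℕ n ,
    (λ z last≼z → toℕ-injective (≤-antisym (subst (toℕ z ≤_) (sym (toℕ-fromℕ n)) (≤-pred (toℕ<n z)))
                                           (≼⇒≤ last≼z))) ,
    (λ y y-maximal → sym (y-maximal (fromℕ n) (≼last y))) ,
    trans (cong g (toℕ-fromℕ n)) last≡1

module _ {m : ℕ} where

  <-mono⇒inflationary : ∀ (f : Fin m → Fin m) → f Preserves Fin._<_ ⟶ Fin._<_ → ∀ x → toℕ x ≤ toℕ (f x)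
  <-mono⇒inflationary f f-mono x = go (toℕ x) x refl
    where
    go : ∀ j x → toℕ x ≡ j → j ≤ toℕ (f x)
    go zero    _ _      = z≤n
    go (suc j) x x≡1+j with toℕ-surjective {m} (<-trans (n<1+n j) (subst (_< m) x≡1+j (toℕ<n x)))
    ... | w , refl = ≤-trans (s≤s (go (toℕ w) w refl)) (f-mono (subst (toℕ w <_) (sym x≡1+j) (n<1+n (toℕ w))))

  <-mono-inverse⇒id : ∀ (f g : Fin m → Fin m) →
                      f Preserves Fin._<_ ⟶ Fin._<_ → g Preserves Fin._<_ ⟶ Fin._<_ →
                      (∀ x → g (f x) ≡ x) → ∀ x → f x ≡ x
  <-mono-inverse⇒id f g f-mono g-mono g∘f≗id x = toℕ-injective (≤-antisym
    (subst (λ y → toℕ (f x) ≤ toℕ y) (g∘f≗id x) (<-mono⇒inflationary g g-mono (f x)))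
    (<-mono⇒inflationary f f-mono x))

-- An isomorphism of good heaps preserves the canonical order, which is the drop order;
-- so it fixes every piece.
heapOf-injective : ∀ {b n g g′} → Good b n g → Good b n g′ →
                   HeapIso (heapOf b n g) (heapOf b n g′) → ∀ j → j ≤ n → g j ≡ g′ j
heapOf-injective {b} {n} {g} {g′} good good′ iso@(σ , σ-lab , _) j j≤n with toℕ-surjective (s≤s j≤n)
... | x , refl = begin
  g (toℕ x)       ≡⟨ σ-lab x ⟨
  g′ (toℕ (to x)) ≡⟨ cong (g′ ∘ toℕ) (<-mono-inverse⇒id to from to-mono from-mono strictlyInverseʳ x) ⟩
  g′ (toℕ x)      ∎
  where
  open ≡-Reasoning
  open Inverse σ using (to; from; strictlyInverseʳ)
  module G  = GoodHeap good
  module G′ = GoodHeap good′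

  to-mono : to Preserves Fin._<_ ⟶ Fin._<_
  to-mono x<y = G′.◁⇒< (HeapIso-◁ {H = heapOf b n g} {H′ = heapOf b n g′} iso (G.<⇒◁ x<y))

  from-mono : from Preserves Fin._<_ ⟶ Fin._<_
  from-mono x<y = G.◁⇒< (HeapIso-◁⁻ {H = heapOf b n g} {H′ = heapOf b n g′} iso (G′.<⇒◁ x<y))

module TypeIIHeap {b n : ℕ} {H : HeapData (suc n)} (isHeap : IsHeap H b)
  (positive : ∀ x → 1 ≤ HeapData.lab H x) (top : Fin (suc n))
  (top-unique : ∀ y → IsMaximal H y → y ≡ top) (lab-top≡1 : HeapData.lab H top ≡ 1)
  where
  open HeapData H
  open HeapTheory H b isHeap

  sequence : ℕ → ℕ
  sequence j with j <? suc n
  ... | yes j<1+n = lab (unrank (fromℕ< j<1+n))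
  ... | no _      = 0

  sequence-toℕ : ∀ k → sequence (toℕ k) ≡ lab (unrank k)
  sequence-toℕ k with toℕ k <? suc n
  ... | yes k<1+n = cong (lab ∘ unrank) (fromℕ<-toℕ k k<1+n)
  ... | no k≮1+n  = contradiction (toℕ<n k) k≮1+n

  sequence-last≡1 : sequence n ≡ 1
  sequence-last≡1 with toℕ-surjective (n<1+n n)
  ... | k , k≡n = begin
    sequence n        ≡⟨ cong sequence k≡n ⟨
    sequence (toℕ k)  ≡⟨ sequence-toℕ k ⟩
    lab (unrank k)    ≡⟨ cong lab (top-unique (unrank k) (rank-max⇒maximal 1+rank≡1+n)) ⟩
    lab top           ≡⟨ lab-top≡1 ⟩
    1                 ∎
    where
    open ≡-Reasoning
    1+rank≡1+n = cong suc (trans (rank-unrank k) k≡n)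

  sequence-positive : ∀ j → j ≤ n → 1 ≤ sequence j
  sequence-positive j j≤n with toℕ-surjective (s≤s j≤n)
  ... | k , refl = subst (1 ≤_) (sym (sequence-toℕ k)) (positive (unrank k))

  sequence-step : ∀ j → j < n → sequence j ≤ sequence (suc j) + b
  sequence-step j j<n with toℕ-surjective (<-trans j<n (n<1+n n)) | toℕ-surjective (s≤s j<n)
  ... | k , refl | k′ , 1+k≡k′ =
    subst₂ (λ u v → u ≤ v + b) (sym (sequence-toℕ k)) (trans (sym (sequence-toℕ k′)) (cong sequence 1+k≡k′))
      (rank-suc⇒≤ (trans (rank-unrank k′) (trans 1+k≡k′ (cong suc (sym (rank-unrank k))))))

  sequence-good : Good b n sequence
  sequence-good = record { last≡1 = sequence-last≡1 ; positive = sequence-positive ; step = sequence-step }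

  heapOf≅ : ∀ {g} → (∀ j → j ≤ n → g j ≡ sequence j) → HeapIso (heapOf b n g) H
  heapOf≅ {g} g≗sequence =
    HeapIso-trans {H₂ = drop b (lab ∘ unrank)} {H₃ = H} (drop-cong g≗lab) drop-canonical≅
    where
    g≗lab : ∀ k → g (toℕ k) ≡ lab (unrank k)
    g≗lab k = trans (g≗sequence (toℕ k) (≤-pred (toℕ<n k))) (sequence-toℕ k)

-- Dyck paths

-- The abscissa of the (k+1)-th up step of w, or of the end point of w once k ≥ countU w.
abscissa : List Step → ℕ → ℕ
abscissa []      _       = 0
abscissa (U ∷ w) zero    = 0
abscissa (U ∷ w) (suc k) = abscissa w k
abscissa (D ∷ w) k       = suc (abscissa w k)

abscissa-end : ∀ w {k} → countU w ≤ k → abscissa w k ≡ countD w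
abscissa-end []      _                 = refl
abscissa-end (U ∷ w) {suc k} (s≤s w≤k) = abscissa-end w w≤k
abscissa-end (D ∷ w) w≤k               = cong suc (abscissa-end w w≤k)

abscissa-mono : ∀ w k → abscissa w k ≤ abscissa w (suc k)
abscissa-mono []      _       = z≤n
abscissa-mono (U ∷ w) zero    = z≤n
abscissa-mono (U ∷ w) (suc k) = abscissa-mono w k
abscissa-mono (D ∷ w) k       = s≤s (abscissa-mono w k)

abscissa-dyckPrefix : ∀ b {u d} w → DyckPrefix b u d w → ∀ k → k < countU w → b * (u + k) ≤ d + abscissa w k
abscissa-dyckPrefix b {u} {d} (U ∷ w) (bu≤d , _) zero _ =
  subst₂ _≤_ (cong (b *_) (sym (+-identityʳ u))) (sym (+-identityʳ d)) bu≤d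
abscissa-dyckPrefix b {u} {d} (U ∷ w) (_ , dyck) (suc k) (s≤s k<w) =
  subst (λ v → b * v ≤ d + abscissa w k) (sym (+-suc u k)) (abscissa-dyckPrefix b w dyck k k<w)
abscissa-dyckPrefix b {u} {d} (D ∷ w) dyck k k<w =
  subst (b * (u + k) ≤_) (sym (+-suc d (abscissa w k))) (abscissa-dyckPrefix b w dyck k k<w)

abscissa-≥ : ∀ b n w → IsDyck b n w → ∀ k → k ≤ n → b * k ≤ abscissa w k
abscissa-≥ b n w (dyck , #U≡n , #D≡bn) k k≤n with m≤n⇒m<n∨m≡n k≤n
... | inj₁ k<n  = abscissa-dyckPrefix b w dyck k (subst (k <_) (sym #U≡n) k<n)
... | inj₂ refl = ≤-reflexive (sym (trans (abscissa-end w (≤-reflexive #U≡n)) #D≡bn))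

abscissa-injective : ∀ {n} w w′ → countU w ≡ n → countU w′ ≡ n →
                     (∀ k → k ≤ n → abscissa w k ≡ abscissa w′ k) → w ≡ w′
abscissa-injective []      []       _    _    _  = refl
abscissa-injective []      (U ∷ _)  refl ()   _
abscissa-injective (U ∷ _) []       refl ()   _
abscissa-injective []      (D ∷ _)  _    _    eq with eq 0 z≤n
... | ()
abscissa-injective (D ∷ _) []       _    _    eq with eq 0 z≤n
... | ()
abscissa-injective (U ∷ _) (D ∷ _)  _    _    eq with eq 0 z≤n
... | ()
abscissa-injective (D ∷ _) (U ∷ _)  _    _    eq with eq 0 z≤n
... | ()
abscissa-injective (U ∷ w) (U ∷ w′) refl #U′ eq =
  cong (U ∷_) (abscissa-injective w w′ refl (suc-injective #U′) λ k k≤n → eq (suc k) (s≤s k≤n))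
abscissa-injective (D ∷ w) (D ∷ w′) #U   #U′ eq =
  cong (D ∷_) (abscissa-injective w w′ #U #U′ λ k k≤n → suc-injective (eq k k≤n))

Monotone : ℕ → (ℕ → ℕ) → Set
Monotone m a = ∀ k → k < m → a k ≤ a (suc k)

Monotone⇒≤ : ∀ {m a} → Monotone m a → ∀ k → k ≤ m → a 0 ≤ a k
Monotone⇒≤ mono zero    _       = ≤-refl
Monotone⇒≤ mono (suc k) 1+k≤m = ≤-trans (Monotone⇒≤ mono k (<⇒≤ 1+k≤m)) (mono k 1+k≤m)

-- From abscissa d: m up steps, the k-th (counted from 0) at abscissa a k, ending at abscissa a m.
pathThrough : ℕ → ℕ → (ℕ → ℕ) → List Step
pathThrough zero    d a = replicate (a 0 ∸ d) D ++ []
pathThrough (suc m) d a = replicate (a 0 ∸ d) D ++ U ∷ pathThrough m (a 0) (a ∘ suc)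

countU-D^ : ∀ t w → countU (replicate t D ++ w) ≡ countU w
countU-D^ zero    w = refl
countU-D^ (suc t) w = countU-D^ t w

abscissa-D^ : ∀ t w k → abscissa (replicate t D ++ w) k ≡ t + abscissa w k
abscissa-D^ zero    w k = refl
abscissa-D^ (suc t) w k = cong suc (abscissa-D^ t w k)

dyckPrefix-D^ : ∀ b u t d w → DyckPrefix b u (t + d) w → DyckPrefix b u d (replicate t D ++ w)
dyckPrefix-D^ b u zero    d w dyck = dyck
dyckPrefix-D^ b u (suc t) d w dyck =
  dyckPrefix-D^ b u t (suc d) w (subst (λ e → DyckPrefix b u e w) (sym (+-suc t d)) dyck)

countU-pathThrough : ∀ m d a → countU (pathThrough m d a) ≡ m
countU-pathThrough zero    d a = countU-D^ (a 0 ∸ d) []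
countU-pathThrough (suc m) d a = trans (countU-D^ (a 0 ∸ d) _) (cong suc (countU-pathThrough m (a 0) (a ∘ suc)))

abscissa-pathThrough : ∀ m d a → d ≤ a 0 → Monotone m a →
                       ∀ k → k ≤ m → abscissa (pathThrough m d a) k ≡ a k ∸ d
abscissa-pathThrough zero    d a d≤a₀ _    zero    _ = trans (abscissa-D^ (a 0 ∸ d) [] 0) (+-identityʳ _)
abscissa-pathThrough (suc m) d a d≤a₀ _    zero    _ = trans (abscissa-D^ (a 0 ∸ d) _ 0) (+-identityʳ _)
abscissa-pathThrough (suc m) d a d≤a₀ mono (suc k) (s≤s k≤m) = begin
  abscissa (pathThrough (suc m) d a) (suc k)
    ≡⟨ abscissa-D^ (a 0 ∸ d) _ (suc k) ⟩
  (a 0 ∸ d) + abscissa (pathThrough m (a 0) (a ∘ suc)) k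
    ≡⟨ cong ((a 0 ∸ d) +_) (abscissa-pathThrough m (a 0) (a ∘ suc) (mono 0 (s≤s z≤n)) mono-suc k k≤m) ⟩
  (a 0 ∸ d) + (a (suc k) ∸ a 0)
    ≡⟨ ∸-telescope d≤a₀ (Monotone⇒≤ mono (suc k) (s≤s k≤m)) ⟩
  a (suc k) ∸ d
    ∎
  where
  open ≡-Reasoning
  mono-suc : Monotone m (a ∘ suc)
  mono-suc j j<m = mono (suc j) (s≤s j<m)

dyckPrefix-pathThrough : ∀ b u m d a → d ≤ a 0 → Monotone m a → (∀ k → k < m → b * (u + k) ≤ a k) →
                         DyckPrefix b u d (pathThrough m d a)
dyckPrefix-pathThrough b u zero    d a _    _    _     = dyckPrefix-D^ b u (a 0 ∸ d) d [] tt
dyckPrefix-pathThrough b u (suc m) d a d≤a₀ mono above = dyckPrefix-D^ b u (a 0 ∸ d) d _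
  (subst (λ e → DyckPrefix b u e (U ∷ pathThrough m (a 0) (a ∘ suc))) (sym (m∸n+n≡m d≤a₀))
    (subst (_≤ a 0) (cong (b *_) (+-identityʳ u)) (above 0 (s≤s z≤n)) ,
     dyckPrefix-pathThrough b (suc u) m (a 0) (a ∘ suc) (mono 0 (s≤s z≤n)) (λ j j<m → mono (suc j) (s≤s j<m))
       (λ k k<m → subst (λ v → b * v ≤ a (suc k)) (+-suc u k) (above (suc k) (s≤s k<m)))))

leftEnd : ℕ → List Step → ℕ → ℕ
leftEnd b w k = abscissa w k ∸ b * k + 1

leftEnd-step : ∀ b j {a a′} → a ≤ a′ → b * suc j ≤ a′ → a ∸ b * j + 1 ≤ a′ ∸ b * suc j + 1 + b
leftEnd-step b j {a} {a′} a≤a′ b[1+j]≤a′ = begin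
  a ∸ b * j + 1              ≤⟨ +-monoˡ-≤ 1 (∸-monoˡ-≤ (b * j) a≤a′) ⟩
  a′ ∸ b * j + 1             ≡⟨ cong (λ x → x ∸ b * j + 1) a′≡r+b+bj ⟩
  r + b + b * j ∸ b * j + 1  ≡⟨ cong (_+ 1) (m+n∸n≡m (r + b) (b * j)) ⟩
  r + b + 1                  ≡⟨ +-assoc r b 1 ⟩
  r + (b + 1)                ≡⟨ cong (r +_) (+-comm b 1) ⟩
  r + (1 + b)                ≡⟨ +-assoc r 1 b ⟨
  r + 1 + b                  ∎
  where
  open ≤-Reasoning
  r = a′ ∸ b * suc j
  a′≡r+b+bj : a′ ≡ r + b + b * j
  a′≡r+b+bj = trans (sym (m∸n+n≡m b[1+j]≤a′)) (trans (cong (r +_) (*-suc b j)) (sym (+-assoc r b (b * j))))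

dyck⇒good : ∀ {b n} w → IsDyck b n w → Good b n (leftEnd b w)
dyck⇒good {b} {n} w dyck@(_ , #U≡n , #D≡bn) = record
  { last≡1   = trans (cong (λ x → x ∸ b * n + 1) (trans (abscissa-end w (≤-reflexive #U≡n)) #D≡bn))
                     (cong (_+ 1) (n∸n≡0 (b * n)))
  ; positive = λ j _ → m≤n+m 1 _
  ; step     = λ j j<n → leftEnd-step b j (abscissa-mono w j) (abscissa-≥ b n w dyck (suc j) j<n)
  }

good⇒dyck : ∀ {b n g} → Good b n g → ∃ λ w → IsDyck b n w × (∀ j → j ≤ n → leftEnd b w j ≡ g j)
good⇒dyck {b} {n} {g} good = w , (dyckPrefix , #U≡n , #D≡bn) , leftEnd≡g
  where
  open Good good
  a : ℕ → ℕ
  a j = g j ∸ 1 + b * j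

  w : List Step
  w = pathThrough n 0 a

  a-mono : Monotone n a
  a-mono j j<n = begin
    g j ∸ 1 + b * j                 ≤⟨ +-monoˡ-≤ (b * j) (∸-monoˡ-≤ 1 (step j j<n)) ⟩
    g (suc j) + b ∸ 1 + b * j       ≡⟨ cong (_+ b * j) (+-∸-comm b (positive (suc j) j<n)) ⟩
    g (suc j) ∸ 1 + b + b * j       ≡⟨ +-assoc (g (suc j) ∸ 1) b (b * j) ⟩
    g (suc j) ∸ 1 + (b + b * j)     ≡⟨ cong (g (suc j) ∸ 1 +_) (*-suc b j) ⟨
    g (suc j) ∸ 1 + b * suc j       ∎
    where open ≤-Reasoning

  abscissa≡a : ∀ j → j ≤ n → abscissa w j ≡ a j
  abscissa≡a = abscissa-pathThrough n 0 a z≤n a-mono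

  dyckPrefix : DyckPrefix b 0 0 w
  dyckPrefix = dyckPrefix-pathThrough b 0 n 0 a z≤n a-mono (λ k _ → m≤n+m (b * k) _)

  #U≡n : countU w ≡ n
  #U≡n = countU-pathThrough n 0 a

  #D≡bn : countD w ≡ b * n
  #D≡bn = trans (sym (abscissa-end w (≤-reflexive #U≡n)))
                (trans (abscissa≡a n ≤-refl) (cong (λ x → x ∸ 1 + b * n) last≡1))

  leftEnd≡g : ∀ j → j ≤ n → leftEnd b w j ≡ g j
  leftEnd≡g j j≤n = begin
    abscissa w j ∸ b * j + 1        ≡⟨ cong (λ x → x ∸ b * j + 1) (abscissa≡a j j≤n) ⟩
    g j ∸ 1 + b * j ∸ b * j + 1     ≡⟨ cong (_+ 1) (m+n∸n≡m (g j ∸ 1) (b * j)) ⟩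
    g j ∸ 1 + 1                     ≡⟨ m∸n+n≡m (positive j j≤n) ⟩
    g j                             ∎
    where open ≡-Reasoning

leftEnd-injective : ∀ {b n} w w′ → IsDyck b n w → IsDyck b n w′ →
                    (∀ k → k ≤ n → leftEnd b w k ≡ leftEnd b w′ k) → w ≡ w′
leftEnd-injective {b} {n} w w′ dyck@(_ , #U≡n , _) dyck′@(_ , #U′≡n , _) same =
  abscissa-injective w w′ #U≡n #U′≡n λ k k≤n →
    ∸-cancelʳ-≡ (abscissa-≥ b n w dyck k k≤n) (abscissa-≥ b n w′ dyck′ k k≤n)
                (+-cancelʳ-≡ 1 _ _ (same k k≤n))

-- The map κ

find-∷-yes : ∀ {A : Set} {P : A → Set} (P? : ∀ x → Dec (P x)) {x} xs →
             P x → find P? (x ∷ xs) ≡ just x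
find-∷-yes P? {x} xs px with P? x
... | yes _ = refl
... | no ¬px = contradiction px ¬px

find-∷-no : ∀ {A : Set} {P : A → Set} (P? : ∀ x → Dec (P x)) {x} xs →
            ¬ P x → find P? (x ∷ xs) ≡ find P? xs
find-∷-no P? {x} xs ¬px with P? x
... | yes px = contradiction px ¬px
... | no _   = refl

find-map : ∀ {A B : Set} {P : B → Set} (P? : ∀ y → Dec (P y)) (f : A → B) xs →
           find P? (map f xs) ≡ Maybe.map f (find (P? ∘ f) xs)
find-map P? f []       = refl
find-map P? f (x ∷ xs) with P? (f x)
... | yes _ = refl
... | no _  = find-map P? f xs

find-cong : ∀ {A : Set} {P Q : A → Set} (P? : ∀ x → Dec (P x)) (Q? : ∀ x → Dec (Q x)) {xs} →
            All (λ x → (P x → Q x) × (Q x → P x)) xs → find P? xs ≡ find Q? xs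
find-cong P? Q? []                         = refl
find-cong P? Q? {x ∷ _} ((P⇒Q , Q⇒P) ∷ rest) with P? x | Q? x
... | yes _  | yes _  = refl
... | no _   | no _   = find-cong P? Q? rest
... | yes px | no ¬qx = contradiction (P⇒Q px) ¬qx
... | no ¬px | yes qx = contradiction (Q⇒P qx) ¬px

find-All : ∀ {A : Set} {P Q : A → Set} (P? : ∀ x → Dec (P x)) {xs x} →
           All Q xs → find P? xs ≡ just x → P x × Q x
find-All P? {y ∷ _} (qy ∷ rest) found with P? y
find-All P? (qy ∷ rest) refl | yes py = py , qy
... | no _ = find-All P? rest found

lastBelow-++ : ∀ q cur xs ys → lastBelow q cur (xs ++ ys) ≡ lastBelow q (lastBelow q cur xs) ys
lastBelow-++ q cur []       ys = refl
lastBelow-++ q cur (_ ∷ xs) ys = lastBelow-++ q _ xs ys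

atMost? : ∀ q (pL : ℕ × ℕ) → Dec (proj₁ pL ≤ q)
atMost? q pL = proj₁ pL ≤? q

lastBelow-reverse : ∀ q cur xs → lastBelow q cur (reverse xs) ≡ fromMaybe cur (find (atMost? q) xs)
lastBelow-reverse q cur []       = refl
lastBelow-reverse q cur (x ∷ xs) = begin
  lastBelow q cur (reverse (x ∷ xs))
    ≡⟨ cong (lastBelow q cur) (unfold-reverse x xs) ⟩
  lastBelow q cur (reverse xs ++ x ∷ [])
    ≡⟨ lastBelow-++ q cur (reverse xs) (x ∷ []) ⟩
  lastBelow q (lastBelow q cur (reverse xs)) (x ∷ [])
    ≡⟨ cong (λ c → lastBelow q c (x ∷ [])) (lastBelow-reverse q cur xs) ⟩
  lastBelow q (fromMaybe cur (find (atMost? q) xs)) (x ∷ [])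
    ≡⟨ last-step x ⟩
  fromMaybe cur (find (atMost? q) (x ∷ xs))
    ∎
  where
  open ≡-Reasoning
  last-step : ∀ x → lastBelow q (fromMaybe cur (find (atMost? q) xs)) (x ∷ [])
                    ≡ fromMaybe cur (find (atMost? q) (x ∷ xs))
  last-step (p , _) with p ≤ᵇ q
  ... | true  = refl
  ... | false = refl

above? : ∀ h (pk : ℕ × ℕ) → Dec (h ≤ proj₂ pk)
above? h pk = h ≤? proj₂ pk

firstAbove : ℕ → List (ℕ × ℕ) → Maybe (ℕ × ℕ)
firstAbove h = find (above? h)

peaksAfterU-reached : ∀ i j w {h} → h ≤ j → maybe proj₁ (i + countD w) (firstAbove h (peaksAfterU i j w)) ≡ i
peaksAfterU-reached i j []      _   = +-identityʳ i
peaksAfterU-reached i j (U ∷ w) h≤j = peaksAfterU-reached i (suc j) w (m≤n⇒m≤1+n h≤j)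
peaksAfterU-reached i j (D ∷ w) h≤j =
  cong (maybe proj₁ (i + countD (D ∷ w))) (find-∷-yes (above? _) (peaks (suc i) j w) h≤j)

mutual
  peaks-firstAbove : ∀ i j d w →
    maybe proj₁ (i + countD w) (firstAbove (suc (j + d)) (peaks i j w)) ≡ i + abscissa w d
  peaks-firstAbove i j d []      = refl
  peaks-firstAbove i j d (U ∷ w) = afterU-firstAbove i j d w
  peaks-firstAbove i j d (D ∷ w) = afterD-firstAbove i j d w

  peaksAfterU-firstAbove : ∀ i j d w →
    maybe proj₁ (i + countD w) (firstAbove (suc (j + d)) (peaksAfterU i j w)) ≡ i + abscissa w d
  peaksAfterU-firstAbove i j d []      = refl
  peaksAfterU-firstAbove i j d (U ∷ w) = afterU-firstAbove i j d w
  peaksAfterU-firstAbove i j d (D ∷ w) =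
    trans (cong (maybe proj₁ (i + countD (D ∷ w))) (find-∷-no (above? _) (peaks (suc i) j w) 1+j+d≰j))
          (afterD-firstAbove i j d w)
    where 1+j+d≰j = <⇒≱ (s≤s (m≤m+n j d))

  afterU-firstAbove : ∀ i j d w →
    maybe proj₁ (i + countD w) (firstAbove (suc (j + d)) (peaksAfterU i (suc j) w)) ≡ i + abscissa (U ∷ w) d
  afterU-firstAbove i j zero    w =
    trans (peaksAfterU-reached i (suc j) w (s≤s (≤-reflexive (+-identityʳ j)))) (sym (+-identityʳ i))
  afterU-firstAbove i j (suc d) w rewrite +-suc j d = peaksAfterU-firstAbove i (suc j) d w

  afterD-firstAbove : ∀ i j d w →
    maybe proj₁ (i + countD (D ∷ w)) (firstAbove (suc (j + d)) (peaks (suc i) j w)) ≡ i + abscissa (D ∷ w) d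
  afterD-firstAbove i j d w rewrite +-suc i (countD w) | +-suc i (abscissa w d) = peaks-firstAbove (suc i) j d w

PeakBounds : ℕ → ℕ → ℕ → ℕ × ℕ → Set
PeakBounds b N M (i , j) = j ≤ N × b * (j ∸ 1) ≤ i × i ≤ M

module _ (b N M : ℕ) where
  mutual
    peaks-bounded : ∀ i j w → DyckPrefix b j i w → j + countU w ≤ N → i + countD w ≤ M →
                    All (PeakBounds b N M) (peaks i j w)
    peaks-bounded i j []      _              _    _    = []
    peaks-bounded i j (U ∷ w) (bj≤i , dyck) j+≤N i+≤M =
      peaksAfterU-bounded i (suc j) w bj≤i dyck (subst (_≤ N) (+-suc j (countU w)) j+≤N) i+≤M
    peaks-bounded i j (D ∷ w) dyck          j+≤N i+≤M =
      peaks-bounded (suc i) j w dyck j+≤N (subst (_≤ M) (+-suc i (countD w)) i+≤M)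

    peaksAfterU-bounded : ∀ i j w → b * (j ∸ 1) ≤ i → DyckPrefix b j i w →
                          j + countU w ≤ N → i + countD w ≤ M → All (PeakBounds b N M) (peaksAfterU i j w)
    peaksAfterU-bounded i j []      _         _              _    _    = []
    peaksAfterU-bounded i j (U ∷ w) _         (bj≤i , dyck) j+≤N i+≤M =
      peaksAfterU-bounded i (suc j) w bj≤i dyck (subst (_≤ N) (+-suc j (countU w)) j+≤N) i+≤M
    peaksAfterU-bounded i j (D ∷ w) b[j-1]≤i dyck          j+≤N i+≤M =
      (≤-trans (m≤m+n j (countU w)) j+≤N , b[j-1]≤i , ≤-trans (m≤m+n i _) i+≤M) ∷
      peaks-bounded (suc i) j w dyck j+≤N (subst (_≤ M) (+-suc i (countD w)) i+≤M)

staircase-value : ∀ b n k i j → suc k ≤ j → j ≤ n → b * (j ∸ 1) ≤ i → i ≤ b * n →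
                  b * (suc n ∸ j) ∸ (b * n ∸ i) + b * ((n ∸ k) ∸ (suc n ∸ j)) ≡ i ∸ b * k
staircase-value b n k i (suc j′) (s≤s k≤j′) j≤n bj′≤i i≤bn
  with t , refl ← m≤n⇒∃[o]m+o≡n k≤j′
  with p , refl ← m≤n⇒∃[o]m+o≡n (≤-trans (n≤1+n j′) j≤n)
  with e , refl ← m≤n⇒∃[o]m+o≡n bj′≤i = begin
  b * (k + t + p ∸ (k + t)) ∸ (b * (k + t + p) ∸ (b * (k + t) + e)) + b * ((k + t + p ∸ k) ∸ (k + t + p ∸ (k + t)))
    ≡⟨ cong₂ (λ u v → b * u ∸ v + b * ((k + t + p ∸ k) ∸ u)) (m+n∸m≡n (k + t) p) bn∸i≡bp∸e ⟩
  b * p ∸ (b * p ∸ e) + b * ((k + t + p ∸ k) ∸ p)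
    ≡⟨ cong₂ (λ u v → u + b * (v ∸ p)) (m∸[m∸n]≡n e≤bp) n∸k≡t+p ⟩
  e + b * (t + p ∸ p)
    ≡⟨ cong (λ u → e + b * u) (m+n∸n≡m t p) ⟩
  e + b * t
    ≡⟨ +-comm e (b * t) ⟩
  b * t + e
    ≡⟨ m+n∸m≡n (b * k) (b * t + e) ⟨
  b * k + (b * t + e) ∸ b * k
    ≡⟨ cong (_∸ b * k) (trans (sym (+-assoc (b * k) (b * t) e)) (cong (_+ e) (sym (*-distribˡ-+ b k t)))) ⟩
  b * (k + t) + e ∸ b * k
    ∎
  where
  open ≡-Reasoning
  b[k+t+p]≡ : b * (k + t + p) ≡ b * (k + t) + b * p
  b[k+t+p]≡ = *-distribˡ-+ b (k + t) p
  bn∸i≡bp∸e : b * (k + t + p) ∸ (b * (k + t) + e) ≡ b * p ∸ e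
  bn∸i≡bp∸e = trans (cong (_∸ (b * (k + t) + e)) b[k+t+p]≡) ([m+n]∸[m+o]≡n∸o (b * (k + t)) (b * p) e)
  n∸k≡t+p : k + t + p ∸ k ≡ t + p
  n∸k≡t+p = trans (cong (_∸ k) (+-assoc k t p)) (m+n∸m≡n k (t + p))
  e≤bp : e ≤ b * p
  e≤bp = +-cancelˡ-≤ (b * (k + t)) e (b * p) (subst (b * (k + t) + e ≤_) b[k+t+p]≡ i≤bn)

toPL : (b : ℕ) .{{_ : NonZero b}} → ℕ × ℕ → ℕ × ℕ
toPL b (l , r) = (r ∸ 1) / b , b * ((r ∸ 1) / b) ∸ l

pLs≡map-toPL : ∀ b .{{_ : NonZero b}} S → pLs b S ≡ map (toPL b) S
pLs≡map-toPL b []      = refl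
pLs≡map-toPL b (x ∷ S) = cong (toPL b x ∷_) (pLs≡map-toPL b S)

stairValue : ℕ → ℕ → ℕ × ℕ → ℕ
stairValue b q (p , L) = L + b * (q ∸ p) + 1

module _ (b n : ℕ) .{{_ : NonZero b}} where

  κ-sequence : List (ℕ × ℕ) → ℕ → ℕ
  κ-sequence S j = cκ b S (n ∸ j)

  pieceOfPeak : ℕ × ℕ → ℕ × ℕ
  pieceOfPeak = toPL b ∘ staircase b n

  pieceOfPeak-p : ∀ i j → proj₁ (pieceOfPeak (i , j)) ≡ suc n ∸ j
  pieceOfPeak-p i j = trans (cong (_/ b) (trans (m+n∸n≡m (b * (suc n ∸ j)) 1) (*-comm b (suc n ∸ j))))
                            (m*n/n≡m (suc n ∸ j) b)

  atMost⇔above : ∀ {k} → k ≤ n → ∀ pk →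
                 (proj₁ (pieceOfPeak pk) ≤ n ∸ k → suc k ≤ proj₂ pk) ×
                 (suc k ≤ proj₂ pk → proj₁ (pieceOfPeak pk) ≤ n ∸ k)
  atMost⇔above {k} k≤n (i , j) rewrite pieceOfPeak-p i j = ⇒ , λ k<j → ∸-monoʳ-≤ (suc n) k<j
    where
    ⇒ : suc n ∸ j ≤ n ∸ k → suc k ≤ j
    ⇒ p≤n∸k with suc k ≤? j
    ... | yes k<j = k<j
    ... | no k≮j  =
      contradiction p≤n∸k
        (<⇒≱ (subst (_≤ suc n ∸ j) (+-∸-assoc 1 k≤n) (∸-monoʳ-≤ (suc n) (≮⇒≥ k≮j))))

  stairValue-peak : ∀ {k i j} → suc k ≤ j → PeakBounds b n (b * n) (i , j) →
                    stairValue b (n ∸ k) (pieceOfPeak (i , j)) ≡ i ∸ b * k + 1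
  stairValue-peak {k} {i} {j} k<j (j≤n , b[j-1]≤i , i≤bn) =
    trans (cong (λ p → b * p ∸ (b * n ∸ i) + b * ((n ∸ k) ∸ p) + 1) (pieceOfPeak-p i j))
          (cong (_+ 1) (staircase-value b n k i j k<j j≤n b[j-1]≤i i≤bn))

  -- At q = n - k, cκ reads the staircase of the first peak at height > k, which sits right after
  -- the (k+1)-th up step; if there is none, the default (p , L) = (0 , 0) applies.
  κ-leftEnd : ∀ w → IsDyck b n w → ∀ k → k ≤ n → κ-sequence (staircases b n w) k ≡ leftEnd b w k
  κ-leftEnd w (prefix , #U≡n , #D≡bn) k k≤n = begin
    cκ b (staircases b n w) (n ∸ k)
      ≡⟨ cong (stairValue b (n ∸ k) ∘ lastBelow (n ∸ k) (0 , 0)) pLs-staircases ⟩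
    stairValue b (n ∸ k) (lastBelow (n ∸ k) (0 , 0) (reverse (map pieceOfPeak P)))
      ≡⟨ cong (stairValue b (n ∸ k)) (lastBelow-reverse (n ∸ k) (0 , 0) (map pieceOfPeak P)) ⟩
    stairValue b (n ∸ k) (fromMaybe (0 , 0) (find (atMost? (n ∸ k)) (map pieceOfPeak P)))
      ≡⟨ cong (stairValue b (n ∸ k) ∘ fromMaybe (0 , 0)) (find-map (atMost? (n ∸ k)) pieceOfPeak P) ⟩
    stairValue b (n ∸ k) (fromMaybe (0 , 0) (Maybe.map pieceOfPeak (find (atMost? (n ∸ k) ∘ pieceOfPeak) P)))
      ≡⟨ cong (stairValue b (n ∸ k) ∘ fromMaybe (0 , 0) ∘ Maybe.map pieceOfPeak)
              (find-cong (atMost? (n ∸ k) ∘ pieceOfPeak) (above? (suc k))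
                         (All.map (λ {pk} _ → atMost⇔above k≤n pk) bounds)) ⟩
    stairValue b (n ∸ k) (fromMaybe (0 , 0) (Maybe.map pieceOfPeak (firstAbove (suc k) P)))
      ≡⟨ first-value (firstAbove (suc k) P) (peaks-firstAbove 0 0 k w) (find-All (above? (suc k)) bounds) ⟩
    leftEnd b w k
      ∎
    where
    open ≡-Reasoning
    P = peaks 0 0 w

    bounds : All (PeakBounds b n (b * n)) P
    bounds = peaks-bounded b n (b * n) 0 0 w prefix (≤-reflexive #U≡n) (≤-reflexive #D≡bn)

    pLs-staircases : pLs b (staircases b n w) ≡ reverse (map pieceOfPeak P)
    pLs-staircases = begin
      pLs b (reverse (map (staircase b n) P))          ≡⟨ pLs≡map-toPL b _ ⟩
      map (toPL b) (reverse (map (staircase b n) P))   ≡⟨ reverse-map (toPL b) (map (staircase b n) P) ⟩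
      reverse (map (toPL b) (map (staircase b n) P))   ≡⟨ cong reverse (map-∘ P) ⟨
      reverse (map pieceOfPeak P)                      ∎

    first-value : ∀ m → maybe proj₁ (countD w) m ≡ abscissa w k →
                  (∀ {x} → m ≡ just x → suc k ≤ proj₂ x × PeakBounds b n (b * n) x) →
                  stairValue b (n ∸ k) (fromMaybe (0 , 0) (Maybe.map pieceOfPeak m)) ≡ leftEnd b w k
    first-value nothing        #D≡abscissa _     =
      cong (_+ 1) (trans (*-distribˡ-∸ b n k) (cong (_∸ b * k) (trans (sym #D≡bn) #D≡abscissa)))
    first-value (just (i , j)) i≡abscissa found with found refl
    ... | k<j , peak-bounds = trans (stairValue-peak k<j peak-bounds) (cong (λ a → a ∸ b * k + 1) i≡abscissa)

  κ-good : ∀ w → IsDyck b n w → Good b n (κ-sequence (staircases b n w))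
  κ-good w dyck = Good-cong (λ j j≤n → sym (κ-leftEnd w dyck j j≤n)) (dyck⇒good w dyck)

  κ-typeII : ∀ S → TypeI b n S → TypeII b n (κ b n S)
  κ-typeII S (w , dyck , refl) = GoodHeap.heapOf-typeII (κ-good w dyck)

  κ-injective : ∀ S S′ → TypeI b n S → TypeI b n S′ → HeapIso (κ b n S) (κ b n S′) → S ≡ S′
  κ-injective S S′ (w , dyck , refl) (w′ , dyck′ , refl) iso =
    cong (staircases b n) (leftEnd-injective w w′ dyck dyck′ λ k k≤n → begin
      leftEnd b w k     ≡⟨ κ-leftEnd w dyck k k≤n ⟨
      κ-sequence S k    ≡⟨ heapOf-injective (κ-good w dyck) (κ-good w′ dyck′) iso k k≤n ⟩
      κ-sequence S′ k   ≡⟨ κ-leftEnd w′ dyck′ k k≤n ⟩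
      leftEnd b w′ k    ∎)
    where open ≡-Reasoning

  κ-surjective : ∀ H → TypeII b n H → Σ[ S ∈ List (ℕ × ℕ) ] (TypeI b n S × HeapIso (κ b n S) H)
  κ-surjective H (isHeap , positive , top , _ , top-unique , lab-top≡1) = via-path (good⇒dyck sequence-good)
    where
    open TypeIIHeap isHeap positive top top-unique lab-top≡1

    via-path : (∃ λ w → IsDyck b n w × ∀ j → j ≤ n → leftEnd b w j ≡ sequence j) →
               Σ[ S ∈ List (ℕ × ℕ) ] (TypeI b n S × HeapIso (κ b n S) H)
    via-path (w , dyck , leftEnd≡sequence) =
      staircases b n w , (w , dyck , refl) ,
      heapOf≅ λ j j≤n → trans (κ-leftEnd w dyck j j≤n) (leftEnd≡sequence j j≤n)

proposition6p4 : (b n : ℕ) .{{_ : NonZero b}} → 1 ≤ n →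
    -- κ maps type I heaps to type II heaps
    ((S : List (ℕ × ℕ)) → TypeI b n S → TypeII b n (κ b n S)) ×
    -- injective (type II heaps are taken up to isomorphism)
    ((S S′ : List (ℕ × ℕ)) → TypeI b n S → TypeI b n S′ →
       HeapIso (κ b n S) (κ b n S′) → S ≡ S′) ×
    -- surjective up to isomorphism
    ((H : HeapData (suc n)) → TypeII b n H →
       Σ[ S ∈ List (ℕ × ℕ) ] (TypeI b n S × HeapIso (κ b n S) H))
proposition6p4 b n _ = κ-typeII b n , κ-injective b n , κ-surjective b n
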